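{- Let $t\geq 1$ and $r\geq 3$, and let $w_1,\dots,w_t,y_{t+1},\dots,y_{r+t}\in\mathbb N_0$. Let $S\subseteq[r+t]\setminus[t]$ be nonempty, and let $m$ be an integer with $m\geq\vert S\vert+\sum_{i=1}^t w_i$. Let \[ \mathcal D=\{\mathbf u\in P(m,r+t): \mathbf u(i)=w_i \text{ for all } i\in[t] \text{ and } \mathbf u(i)=y_i \text{ for some } i\in S\}. \] If $\sum_{s\in S}y_s>0$, then \[ \vert\mathcal D\vert<\sum_{0\leq d\leq\vert S\vert-1}\binom{m-\sum_{i=1}^t w_i-d+r-2}{r-2}. \]
   Context: $\mathbb N_0$ is the set of non-negative integers, $[k]=\{1,\dots,k\}$, and $P(m,k)=\{(x_1,\dots,x_k)\in\mathbb N_0^k : x_1+\cdots+x_k=m\}$; for $\mathbf u=(u_1,\dots,u_k)$, $\mathbf u(i)=u_i$. -}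

module Defs where

open import Data.Nat using (ℕ; zero; suc; _≟_; _+_)
open import Data.Fin using (Fin; _↑ˡ_; _↑ʳ_)
open import Data.Fin.Subset using (Subset; _∈_)
open import Data.Fin.Subset.Properties using (_∈?_)
open import Data.Fin.Properties using (all?; any?)
open import Data.Vec using (Vec; []; _∷_; lookup; sum; tabulate)
open import Data.List using (List; [_]; concatMap; map; upTo; filter; length)
open import Data.Product using (_×_; ∃)
open import Relation.Nullary using (Dec; yes; no)
open import Relation.Nullary.Decidable using (_×-dec_)
open import Relation.Binary.PropositionalEquality using (_≡_)

vecsBelow : (k n : ℕ) → List (Vec ℕ k)
vecsBelow zero    n = [ [] ]
vecsBelow (suc k) n = concatMap (λ a → map (a ∷_) (vecsBelow k n)) (upTo n)

-- P(m,k) = { u ∈ ℕ₀^k : u(1)+…+u(k) = m }, as a duplicate-free list.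
-- (Every such u has all entries ≤ m, so it occurs in vecsBelow k (suc m).)
P : (m k : ℕ) → List (Vec ℕ k)
P m k = filter (λ u → sum u ≟ m) (vecsBelow k (suc m))

-- Coordinates [r+t] are Fin (t + r): coordinate i ∈ [t] is i ↑ˡ r (i : Fin t),
-- coordinate t+s ∈ [r+t]∖[t] is t ↑ʳ s (s : Fin r).
InD : (t r : ℕ) (w : Fin t → ℕ) (y : Fin r → ℕ) (S : Subset r) → Vec ℕ (t + r) → Set
InD t r w y S u =
  (∀ i → lookup u (i ↑ˡ r) ≡ w i) × ∃ (λ s → s ∈ S × lookup u (t ↑ʳ s) ≡ y s)

InD? : (t r : ℕ) (w : Fin t → ℕ) (y : Fin r → ℕ) (S : Subset r) → (u : Vec ℕ (t + r)) → Dec (InD t r w y S u)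
InD? t r w y S u =
  all? (λ i → lookup u (i ↑ˡ r) ≟ w i)
  ×-dec any? (λ s → (s ∈? S) ×-dec (lookup u (t ↑ʳ s) ≟ y s))

𝒟 : (t r : ℕ) (w : Fin t → ℕ) (y : Fin r → ℕ) (S : Subset r) (m : ℕ) → List (Vec ℕ (t + r))
𝒟 t r w y S m = filter (InD? t r w y S) (P m (t + r))

sumOver : {r : ℕ} → Subset r → (Fin r → ℕ) → ℕ
sumOver {r} S y = sum (tabulate λ s → ind (s ∈? S) (y s))
  where
  ind : {A : Set} → Dec A → ℕ → ℕ
  ind (yes _) n = n
  ind (no _)  _ = 0

-- Counting by the t pinned coordinates, |𝒟| is the number of compositions of M = m ∸ Σ w
-- into r parts that take the value y s at some s ∈ S: all compositions minus those avoiding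
-- every y s. Telescoping Pascal's rule, the bound is all compositions minus those avoiding 0
-- at every s ∈ S. So it suffices that forbidding the values y s leaves strictly more
-- compositions than forbidding 0. Forbidding the value c in one coordinate removes the term
-- g (M ∸ c) from Σ_x g (M ∸ x), where by induction g may be taken to count the remaining
-- coordinates with 0 forbidden; this g is nondecreasing, so at most the term g M removed by
-- c = 0 is lost, and strictly less when c > 0 and at least two coordinates remain. The count
-- is symmetric in the coordinates, so the coordinate with y s > 0 may be taken first.
module Submission where

open import Defs
open import Data.Nat.Properties
open import Algebra.Properties.CommutativeSemigroup +-commutativeSemigroup
  using () renaming (interchange to +-interchange; xy∙z≈xz∙y to +-swapʳ)
open import Algebra.Properties.CommutativeSemigroup *-commutativeSemigroup
  using () renaming (x∙yz≈y∙xz to *-swapˡ)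
open import Data.Bool using (Bool; true; false; if_then_else_; T)
open import Data.Empty using (⊥-elim)
open import Data.Fin using (Fin; zero; suc)
open import Data.Fin.Properties using (any?)
open import Data.Fin.Subset using (Subset; Nonempty; ∣_∣; _∈_)
open import Data.Fin.Subset.Properties using (_∈?_)
open import Data.List using (List; []; _∷_; _++_; length; map; filter; concatMap; applyUpTo; upTo)
open import Data.List.Membership.Propositional using () renaming (_∈_ to _∈ₗ_)
open import Data.List.Membership.Propositional.Properties using (∈-∃++)
open import Data.List.Properties using (length-++; length-++-sucʳ; filter-++; filter-≐; filter-none)
open import Data.List.Relation.Unary.All using (universal)
import Data.List.Relation.Unary.Any as Any
open import Data.Maybe using (Maybe; just; nothing)
import Data.Maybe.Properties as Maybe
open import Data.Nat using (ℕ; zero; suc; _+_; _*_; _∸_; _≤_; _<_; _≥_; z≤n; s≤s; z<s; _≡ᵇ_)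
open import Data.Nat.Combinatorics using (_C_; nCn≡1; nCk+nC[k+1]≡[n+1]C[k+1])
open import Data.Nat.ListAction using () renaming (sum to listSum)
open import Data.Product using (_×_; _,_; proj₁; proj₂; ∃)
open import Data.Sum using (_⊎_; inj₁; inj₂; [_,_])
open import Data.Unit using (tt)
open import Data.Vec using (Vec; []; _∷_; lookup; sum; tabulate)
open import Data.Vec.Base using (here; there)
open import Function using (_∘_; id)
open import Level using (0ℓ)
open import Relation.Binary.PropositionalEquality
  using (_≡_; _≢_; refl; sym; trans; cong; cong₂; subst; subst₂; module ≡-Reasoning)
open import Relation.Nullary using (Dec; yes; no; ¬_; ¬?; does; contradiction)
open import Relation.Nullary.Decidable using (_×-dec_)
open import Relation.Unary using (Pred; Decidable; _≐_)
open import Relation.Unary.Properties using (U?)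

-- Sums over antidiagonals

conv : ℕ → (ℕ → ℕ → ℕ) → ℕ
conv zero    F = F 0 0
conv (suc N) F = F 0 (suc N) + conv N (λ x z → F (suc x) z)

conv-cong : ∀ N {F G : ℕ → ℕ → ℕ} → (∀ x z → x + z ≡ N → F x z ≡ G x z) → conv N F ≡ conv N G
conv-cong zero    F≡G = F≡G 0 0 refl
conv-cong (suc N) F≡G =
  cong₂ _+_ (F≡G 0 (suc N) refl) (conv-cong N (λ x z eq → F≡G (suc x) z (cong suc eq)))

conv-mono : ∀ N {F G : ℕ → ℕ → ℕ} → (∀ x z → F x z ≤ G x z) → conv N F ≤ conv N G
conv-mono zero    F≤G = F≤G 0 0
conv-mono (suc N) F≤G = +-mono-≤ (F≤G 0 (suc N)) (conv-mono N (λ x z → F≤G (suc x) z))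

conv-zero : ∀ N {F : ℕ → ℕ → ℕ} → (∀ x z → x + z ≡ N → F x z ≡ 0) → conv N F ≡ 0
conv-zero zero    F≡0 = F≡0 0 0 refl
conv-zero (suc N) F≡0 =
  cong₂ _+_ (F≡0 0 (suc N) refl) (conv-zero N (λ x z eq → F≡0 (suc x) z (cong suc eq)))

conv-single : ∀ N c {F : ℕ → ℕ → ℕ} → c ≤ N → (∀ x z → x + z ≡ N → x ≢ c → F x z ≡ 0) →
              conv N F ≡ F c (N ∸ c)
conv-single zero    zero    _         _    = refl
conv-single (suc N) zero    {F} _     F≡0 =
  trans (cong (F 0 (suc N) +_) (conv-zero N (λ x z eq → F≡0 (suc x) z (cong suc eq) λ ()))) (+-identityʳ _)
conv-single (suc N) (suc c) (s≤s c≤N) F≡0 =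
  cong₂ _+_ (F≡0 0 (suc N) refl λ ())
            (conv-single N c c≤N (λ x z eq x≢c → F≡0 (suc x) z (cong suc eq) (x≢c ∘ suc-injective)))

conv-last : ∀ N (F : ℕ → ℕ → ℕ) → F N 0 ≤ conv N F
conv-last zero    F = ≤-refl
conv-last (suc N) F = ≤-trans (conv-last N (λ x z → F (suc x) z)) (m≤n+m _ _)

*-distribˡ-conv : ∀ N c (F : ℕ → ℕ → ℕ) → c * conv N F ≡ conv N (λ x z → c * F x z)
*-distribˡ-conv zero    c F = refl
*-distribˡ-conv (suc N) c F =
  trans (*-distribˡ-+ c _ _) (cong (c * F 0 (suc N) +_) (*-distribˡ-conv N c _))

conv-swap : ∀ N (F : ℕ → ℕ → ℕ → ℕ) →
  conv N (λ x z → conv z (λ x′ u → F x x′ u)) ≡ conv N (λ x′ z → conv z (λ x u → F x x′ u))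
conv-swap zero          F = refl
conv-swap (suc zero)    F = +-swapʳ (F 0 0 1) (F 0 1 0) (F 1 0 0)
conv-swap (suc (suc N)) F = begin
  (F 0 0 (2 + N) + C₀) + conv (suc N) (λ x z → conv z (λ x′ u → F (suc x) x′ u))
    ≡⟨ cong (F 0 0 (2 + N) + C₀ +_) (conv-swap (suc N) (λ x → F (suc x))) ⟩
  (F 0 0 (2 + N) + C₀) + (C₁ + conv N (λ x′ z → conv z (λ x u → F (suc x) (suc x′) u)))
    ≡⟨ +-interchange (F 0 0 (2 + N)) C₀ C₁ _ ⟩
  (F 0 0 (2 + N) + C₁) + (C₀ + conv N (λ x′ z → conv z (λ x u → F (suc x) (suc x′) u)))
    ≡⟨ cong (λ R → F 0 0 (2 + N) + C₁ + (C₀ + R)) (sym (conv-swap N (λ x x′ → F (suc x) (suc x′)))) ⟩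
  (F 0 0 (2 + N) + C₁) + conv (suc N) (λ x z → conv z (λ x′ u → F x (suc x′) u))
    ≡⟨ cong (F 0 0 (2 + N) + C₁ +_) (conv-swap (suc N) (λ x x′ → F x (suc x′))) ⟩
  (F 0 0 (2 + N) + C₁) + conv (suc N) (λ x′ z → conv z (λ x u → F x (suc x′) u)) ∎
  where
  open ≡-Reasoning
  C₀ C₁ : ℕ
  C₀ = conv (suc N) (λ x′ u → F 0 (suc x′) u)
  C₁ = conv (suc N) (λ x u → F (suc x) 0 u)

map-applyUpTo : ∀ {A B : Set} (f : A → B) (g : ℕ → A) n → map f (applyUpTo g n) ≡ applyUpTo (f ∘ g) n
map-applyUpTo f g zero    = refl
map-applyUpTo f g (suc n) = cong (f (g 0) ∷_) (map-applyUpTo f (g ∘ suc) n)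

sum-applyUpTo-zero : ∀ n (f : ℕ → ℕ) → (∀ a → a < n → f a ≡ 0) → listSum (applyUpTo f n) ≡ 0
sum-applyUpTo-zero zero    f f≡0 = refl
sum-applyUpTo-zero (suc n) f f≡0 =
  cong₂ _+_ (f≡0 0 z<s) (sum-applyUpTo-zero n (f ∘ suc) (λ a a<n → f≡0 (suc a) (s≤s a<n)))

sum-applyUpTo≡conv : ∀ N n (f : ℕ → ℕ) → N < n → (∀ a → N < a → a < n → f a ≡ 0) →
                     listSum (applyUpTo f n) ≡ conv N (λ a _ → f a)
sum-applyUpTo≡conv zero    (suc n) f _         f≡0 =
  trans (cong (f 0 +_) (sum-applyUpTo-zero n (f ∘ suc) (λ a a<n → f≡0 (suc a) z<s (s≤s a<n))))
        (+-identityʳ (f 0))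
sum-applyUpTo≡conv (suc N) (suc n) f (s≤s N<n) f≡0 =
  cong (f 0 +_) (sum-applyUpTo≡conv N n (f ∘ suc) N<n (λ a N<a a<n → f≡0 (suc a) (s≤s N<a) (s≤s a<n)))

sum-applyUpTo-telescope : ∀ k (f g : ℕ → ℕ) → (∀ d → d < k → f d + g (suc d) ≡ g d) →
                          listSum (applyUpTo f k) + g k ≡ g 0
sum-applyUpTo-telescope zero    f g _    = refl
sum-applyUpTo-telescope (suc k) f g step = begin
  f 0 + listSum (applyUpTo (f ∘ suc) k) + g (suc k)
    ≡⟨ +-assoc (f 0) _ _ ⟩
  f 0 + (listSum (applyUpTo (f ∘ suc) k) + g (suc k))
    ≡⟨ cong (f 0 +_) (sum-applyUpTo-telescope k (f ∘ suc) (g ∘ suc) step′) ⟩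
  f 0 + g 1
    ≡⟨ step 0 z<s ⟩
  g 0 ∎
  where
  open ≡-Reasoning
  step′ : ∀ d → d < k → f (suc d) + g (suc (suc d)) ≡ g (suc d)
  step′ d d<k = step (suc d) (s≤s d<k)

-- Compositions

comps : ℕ → ℕ → ℕ
comps N       (suc q) = conv N (λ _ z → comps z q)
comps zero    zero    = 1
comps (suc _) zero    = 0

-- comps∸ N k q counts q-tuples of sum N with k given entries positive:
-- comps (N ∸ k) q if k ≤ N, and 0 (not comps 0 q) if k > N.
comps∸ : ℕ → ℕ → ℕ → ℕ
comps∸ N       zero    q = comps N q
comps∸ zero    (suc k) q = 0
comps∸ (suc N) (suc k) q = comps∸ N k q

comps-zero : ∀ q → comps 0 q ≡ 1
comps-zero zero    = refl
comps-zero (suc q) = comps-zero q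

comps-one : ∀ N → comps N 1 ≡ 1
comps-one zero    = refl
comps-one (suc N) = comps-one N

comps-pos : ∀ N q → 1 ≤ comps N (suc q)
comps-pos N q = ≤-trans (≤-reflexive (sym (comps-zero q))) (conv-last N (λ _ z → comps z q))

comps-binomial : ∀ N q → comps N (suc q) ≡ (N + q) C q
comps-binomial N       zero    = comps-one N
comps-binomial zero    (suc q) = trans (comps-zero (suc (suc q))) (sym (nCn≡1 (suc q)))
comps-binomial (suc N) (suc q) = begin
  comps (suc N) (suc q) + comps N (suc (suc q)) ≡⟨ cong₂ _+_ (comps-binomial (suc N) q) (comps-binomial N (suc q)) ⟩
  (suc N + q) C q + (N + suc q) C suc q         ≡⟨ cong (λ n → n C q + (N + suc q) C suc q) (sym (+-suc N q)) ⟩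
  (N + suc q) C q + (N + suc q) C suc q         ≡⟨ nCk+nC[k+1]≡[n+1]C[k+1] (N + suc q) q ⟩
  suc (N + suc q) C suc q                       ∎
  where open ≡-Reasoning

comps∸-∸ : ∀ N k q → k ≤ N → comps∸ N k q ≡ comps (N ∸ k) q
comps∸-∸ N       zero    q _         = refl
comps∸-∸ (suc N) (suc k) q (s≤s k≤N) = comps∸-∸ N k q k≤N

comps∸-pos : ∀ N k q → k ≤ N → 1 ≤ comps∸ N k (suc q)
comps∸-pos N       zero    q _         = comps-pos N q
comps∸-pos (suc N) (suc k) q (s≤s k≤N) = comps∸-pos N k q k≤N

comps∸-pascal : ∀ N k q → comps∸ N k (suc q) ≡ comps∸ N k q + comps∸ N (suc k) (suc q)
comps∸-pascal zero    zero    q = sym (+-identityʳ _)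
comps∸-pascal (suc N) zero    q = refl
comps∸-pascal zero    (suc k) q = refl
comps∸-pascal (suc N) (suc k) q = comps∸-pascal N k q

comps∸-suc : ∀ N k q → comps∸ (suc N) k (suc q) ≡ comps∸ (suc N) k q + comps∸ N k (suc q)
comps∸-suc N       zero          q = refl
comps∸-suc zero    (suc zero)    q = sym (+-identityʳ _)
comps∸-suc zero    (suc (suc k)) q = refl
comps∸-suc (suc N) (suc k)       q = comps∸-suc N k q

conv-comps∸ : ∀ N k q → conv N (λ _ z → comps∸ z k q) ≡ comps∸ N k (suc q)
conv-comps∸ N       zero    q = refl
conv-comps∸ zero    (suc k) q = refl
conv-comps∸ (suc N) (suc k) q =
  trans (cong (comps∸ N k q +_) (conv-comps∸ N (suc k) q)) (sym (comps∸-pascal N k q))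

comps∸-mono : ∀ N k q → comps∸ N k (suc q) ≤ comps∸ (suc N) k (suc q)
comps∸-mono N k q = ≤-trans (m≤n+m _ _) (≤-reflexive (sym (comps∸-suc N k q)))

comps∸-strict : ∀ N k q → k ≤ suc N → comps∸ N k (suc (suc q)) < comps∸ (suc N) k (suc (suc q))
comps∸-strict N k q k≤1+N =
  ≤-trans (+-monoˡ-≤ _ (comps∸-pos (suc N) k q k≤1+N)) (≤-reflexive (sym (comps∸-suc N k (suc q))))

sum-binomial+comps∸ : ∀ M k r → 2 ≤ r → k ≤ M →
  listSum (map (λ d → (M ∸ d + r ∸ 2) C (r ∸ 2)) (upTo k)) + comps∸ M k r ≡ comps M r
sum-binomial+comps∸ M k _ (s≤s (s≤s {n = q} _)) k≤M =
  trans (cong (λ xs → listSum xs + comps∸ M k (suc (suc q))) (map-applyUpTo _ _ k))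
        (sum-applyUpTo-telescope k _ (λ d → comps∸ M d (suc (suc q))) pascal-step)
  where
  term≡comps∸ : ∀ d → d < k → (M ∸ d + suc (suc q) ∸ 2) C q ≡ comps∸ M d (suc q)
  term≡comps∸ d d<k = begin
    (M ∸ d + suc (suc q) ∸ 2) C q ≡⟨ cong (_C q) (+-∸-assoc (M ∸ d) (s≤s (s≤s z≤n))) ⟩
    (M ∸ d + q) C q               ≡⟨ sym (comps-binomial (M ∸ d) q) ⟩
    comps (M ∸ d) (suc q)         ≡⟨ sym (comps∸-∸ M d (suc q) (<⇒≤ (<-≤-trans d<k k≤M))) ⟩
    comps∸ M d (suc q)            ∎
    where open ≡-Reasoning
  pascal-step : ∀ d → d < k →
    (M ∸ d + suc (suc q) ∸ 2) C q + comps∸ M (suc d) (suc (suc q)) ≡ comps∸ M d (suc (suc q))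
  pascal-step d d<k =
    trans (cong (_+ comps∸ M (suc d) (suc (suc q))) (term≡comps∸ d d<k)) (sym (comps∸-pascal M d (suc q)))

-- Compositions with forbidden values

-- A mask list has one entry per coordinate: nothing leaves it free, just c forbids the value c.
allows : Maybe ℕ → ℕ → ℕ
allows nothing  _ = 1
allows (just c) x = if c ≡ᵇ x then 0 else 1

avoiding : List (Maybe ℕ) → ℕ → ℕ
avoiding []      N = comps N 0
avoiding (μ ∷ τ) N = conv N (λ x z → allows μ x * avoiding τ z)

constrained : List (Maybe ℕ) → ℕ
constrained []            = 0
constrained (nothing ∷ τ) = constrained τ
constrained (just _ ∷ τ)  = suc (constrained τ)

allows-self : ∀ c → allows (just c) c ≡ 0
allows-self zero    = refl
allows-self (suc c) = allows-self c

allows-≢ : ∀ μ a → μ ≢ just a → allows μ a ≡ 1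
allows-≢ nothing  a _ = refl
allows-≢ (just c) a μ≢a with c ≡ᵇ a in c≡ᵇa
... | true  = ⊥-elim (μ≢a (cong just (≡ᵇ⇒≡ c a (subst T (sym c≡ᵇa) tt))))
... | false = refl

allows≤1 : ∀ μ x → allows μ x ≤ 1
allows≤1 nothing  x = ≤-refl
allows≤1 (just c) x with c ≡ᵇ x
... | true  = z≤n
... | false = ≤-refl

avoiding≤comps : ∀ τ N → avoiding τ N ≤ comps N (length τ)
avoiding≤comps []      N = ≤-refl
avoiding≤comps (μ ∷ τ) N = conv-mono N λ x z → begin
  allows μ x * avoiding τ z ≤⟨ *-monoˡ-≤ (avoiding τ z) (allows≤1 μ x) ⟩
  1 * avoiding τ z          ≡⟨ *-identityˡ (avoiding τ z) ⟩
  avoiding τ z              ≤⟨ avoiding≤comps τ z ⟩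
  comps z (length τ)        ∎
  where open ≤-Reasoning

avoiding-swap : ∀ μ ν τ M → avoiding (μ ∷ ν ∷ τ) M ≡ avoiding (ν ∷ μ ∷ τ) M
avoiding-swap μ ν τ M = begin
  conv M (λ x z → allows μ x * conv z (λ x′ u → allows ν x′ * avoiding τ u))
    ≡⟨ conv-cong M (λ x z _ → *-distribˡ-conv z (allows μ x) _) ⟩
  conv M (λ x z → conv z (λ x′ u → allows μ x * (allows ν x′ * avoiding τ u)))
    ≡⟨ conv-swap M _ ⟩
  conv M (λ x′ z → conv z (λ x u → allows μ x * (allows ν x′ * avoiding τ u)))
    ≡⟨ conv-cong M (λ x′ z _ → conv-cong z (λ x u _ → *-swapˡ (allows μ x) (allows ν x′) _)) ⟩
  conv M (λ x′ z → conv z (λ x u → allows ν x′ * (allows μ x * avoiding τ u)))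
    ≡⟨ conv-cong M (λ x′ z _ → sym (*-distribˡ-conv z (allows ν x′) _)) ⟩
  conv M (λ x′ z → allows ν x′ * conv z (λ x u → allows μ x * avoiding τ u)) ∎
  where open ≡-Reasoning

avoiding-move : ∀ τ₁ μ τ₂ M → avoiding (τ₁ ++ μ ∷ τ₂) M ≡ avoiding (μ ∷ τ₁ ++ τ₂) M
avoiding-move []       μ τ₂ M = refl
avoiding-move (ν ∷ τ₁) μ τ₂ M =
  trans (conv-cong M (λ x z _ → cong (allows ν x *_) (avoiding-move τ₁ μ τ₂ z)))
        (avoiding-swap ν μ (τ₁ ++ τ₂) M)

constrained-move : ∀ τ₁ μ τ₂ → constrained (τ₁ ++ μ ∷ τ₂) ≡ constrained (μ ∷ τ₁ ++ τ₂)
constrained-move []             μ         τ₂ = refl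
constrained-move (nothing ∷ τ₁) nothing   τ₂ = constrained-move τ₁ nothing τ₂
constrained-move (nothing ∷ τ₁) (just c)  τ₂ = constrained-move τ₁ (just c) τ₂
constrained-move (just _ ∷ τ₁)  nothing   τ₂ = cong suc (constrained-move τ₁ nothing τ₂)
constrained-move (just _ ∷ τ₁)  (just c)  τ₂ = cong suc (constrained-move τ₁ (just c) τ₂)

-- termAt a M f is the term x = a of Σ_{x + z = M} f z: f (M ∸ a) if a ≤ M, else 0.
termAt : ℕ → ℕ → (ℕ → ℕ) → ℕ
termAt zero    M       f = f M
termAt (suc a) zero    f = 0
termAt (suc a) (suc M) f = termAt a M f

termAt-≤ : ∀ a M {f : ℕ → ℕ} → (∀ z → f z ≤ f (suc z)) → termAt a M f ≤ f M
termAt-≤ zero    M       _    = ≤-refl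
termAt-≤ (suc a) zero    _    = z≤n
termAt-≤ (suc a) (suc M) mono = ≤-trans (termAt-≤ a M mono) (mono M)

termAt-bound : ∀ a M {f : ℕ → ℕ} {c} → (∀ z → f z ≤ c) → termAt a M f ≤ c
termAt-bound zero    M       f≤c = f≤c M
termAt-bound (suc a) zero    f≤c = z≤n
termAt-bound (suc a) (suc M) f≤c = termAt-bound a M f≤c

termAt-comps∸< : ∀ a M k q → k ≤ M →
  termAt (suc a) M (λ z → comps∸ z k (suc (suc q))) < comps∸ M k (suc (suc q))
termAt-comps∸< a zero    zero q _   = comps-pos 0 (suc q)
termAt-comps∸< a (suc M) k    q k≤M = begin-strict
  termAt a M (λ z → comps∸ z k (suc (suc q))) ≤⟨ termAt-≤ a M (λ z → comps∸-mono z k (suc q)) ⟩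
  comps∸ M k (suc (suc q))                     <⟨ comps∸-strict M k q k≤M ⟩
  comps∸ (suc M) k (suc (suc q))               ∎
  where open ≤-Reasoning

conv-split : ∀ M a (f : ℕ → ℕ) →
  conv M (λ x z → allows (just a) x * f z) + termAt a M f ≡ conv M (λ _ z → f z)
conv-split zero    zero    f = refl
conv-split zero    (suc a) f = trans (+-identityʳ _) (+-identityʳ (f 0))
conv-split (suc M) zero    f =
  trans (+-comm _ (f (suc M))) (cong (f (suc M) +_) (conv-cong M (λ _ z _ → *-identityˡ (f z))))
conv-split (suc M) (suc a) f =
  trans (+-assoc (1 * f (suc M)) _ _) (cong₂ _+_ (*-identityˡ (f (suc M))) (conv-split M a f))

conv-allows-comps∸ : ∀ a M k q →
  conv M (λ x z → allows (just a) x * comps∸ z k q) + termAt a M (λ z → comps∸ z k q)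
    ≡ comps∸ M k q + comps∸ M (suc k) (suc q)
conv-allows-comps∸ a M k q =
  trans (conv-split M a _) (trans (conv-comps∸ M k q) (comps∸-pascal M k q))

comps∸-step : ∀ μ k q {h : ℕ → ℕ} → (∀ z → comps∸ z k (suc q) ≤ h z) →
  ∀ M → comps∸ M (constrained (μ ∷ []) + k) (suc (suc q)) ≤ conv M (λ x z → allows μ x * h z)
comps∸-step nothing  k q {h} IH M = begin
  comps∸ M k (suc (suc q))             ≡⟨ sym (conv-comps∸ M k (suc q)) ⟩
  conv M (λ _ z → comps∸ z k (suc q))  ≤⟨ conv-mono M (λ _ z → IH z) ⟩
  conv M (λ _ z → h z)                 ≡⟨ conv-cong M (λ _ z _ → sym (*-identityˡ (h z))) ⟩
  conv M (λ x z → 1 * h z)             ∎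
  where open ≤-Reasoning
comps∸-step (just a) k q {h} IH M = ≤-trans lower (conv-mono M (λ x z → *-monoʳ-≤ (allows (just a) x) (IH z)))
  where
  open ≤-Reasoning
  g : ℕ → ℕ
  g z = comps∸ z k (suc q)
  G : ℕ
  G = conv M (λ x z → allows (just a) x * g z)
  lower : comps∸ M (suc k) (suc (suc q)) ≤ G
  lower = +-cancelˡ-≤ (g M) _ _ (begin
    g M + comps∸ M (suc k) (suc (suc q)) ≡⟨ sym (conv-allows-comps∸ a M k (suc q)) ⟩
    G + termAt a M g                     ≤⟨ +-monoʳ-≤ G (termAt-≤ a M (λ z → comps∸-mono z k q)) ⟩
    G + g M                              ≡⟨ +-comm G (g M) ⟩
    g M + G                              ∎)

comps∸-step-strict : ∀ a k q {h : ℕ → ℕ} → (∀ z → comps∸ z k (suc (suc q)) ≤ h z) →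
  ∀ M → k ≤ M → comps∸ M (suc k) (suc (suc (suc q))) < conv M (λ x z → allows (just (suc a)) x * h z)
comps∸-step-strict a k q {h} IH M k≤M =
  <-≤-trans lower (conv-mono M (λ x z → *-monoʳ-≤ (allows (just (suc a)) x) (IH z)))
  where
  open ≤-Reasoning
  g : ℕ → ℕ
  g z = comps∸ z k (suc (suc q))
  G : ℕ
  G = conv M (λ x z → allows (just (suc a)) x * g z)
  lower : comps∸ M (suc k) (suc (suc (suc q))) < G
  lower = +-cancelˡ-< (g M) _ _ (begin-strict
    g M + comps∸ M (suc k) (suc (suc (suc q))) ≡⟨ sym (conv-allows-comps∸ (suc a) M k (suc (suc q))) ⟩
    G + termAt (suc a) M g                     <⟨ +-monoʳ-< G (termAt-comps∸< a M k q k≤M) ⟩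
    G + g M                                    ≡⟨ +-comm G (g M) ⟩
    g M + G                                    ∎)

comps∸≤avoiding-free : ∀ τ M → comps∸ M (constrained τ) (suc (length τ)) ≤ avoiding (nothing ∷ τ) M
comps∸≤avoiding-free []             M = ≤-trans (≤-reflexive (comps-one M)) (conv-last M _)
comps∸≤avoiding-free (nothing ∷ τ)  M =
  comps∸-step nothing (constrained τ) (length τ) (comps∸≤avoiding-free τ) M
comps∸≤avoiding-free (just a ∷ τ)   M =
  ≤-trans (comps∸-step (just a) (constrained τ) (length τ) (comps∸≤avoiding-free τ) M)
          (≤-reflexive (avoiding-swap (just a) nothing τ M))

comps∸≤avoiding-pair : ∀ a b M → comps∸ M 2 2 ≤ avoiding (just a ∷ just b ∷ []) M
comps∸≤avoiding-pair a b zero    = z≤n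
comps∸≤avoiding-pair a b (suc M) = +-cancelˡ-≤ 1 _ _ (begin
  1 + comps∸ (suc M) 2 2
    ≡⟨ cong (_+ comps∸ (suc M) 2 2) (sym (comps-one M)) ⟩
  comps∸ (suc M) 1 1 + comps∸ (suc M) 2 2
    ≡⟨ sym (comps∸-pascal (suc M) 1 1) ⟩
  comps∸ (suc M) 1 2
    ≤⟨ comps∸≤avoiding-free (just b ∷ []) (suc M) ⟩
  conv (suc M) (λ x z → 1 * h z)
    ≡⟨ conv-cong (suc M) (λ _ z _ → *-identityˡ (h z)) ⟩
  conv (suc M) (λ _ z → h z)
    ≡⟨ sym (conv-split (suc M) a h) ⟩
  avoiding (just a ∷ just b ∷ []) (suc M) + termAt a (suc M) h
    ≤⟨ +-monoʳ-≤ _ (termAt-bound a (suc M) h≤1) ⟩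
  avoiding (just a ∷ just b ∷ []) (suc M) + 1
    ≡⟨ +-comm _ 1 ⟩
  1 + avoiding (just a ∷ just b ∷ []) (suc M) ∎)
  where
  open ≤-Reasoning
  h : ℕ → ℕ
  h = avoiding (just b ∷ [])
  h≤1 : ∀ z → h z ≤ 1
  h≤1 z = ≤-trans (avoiding≤comps (just b ∷ []) z) (≤-reflexive (comps-one z))

-- At least two coordinates are needed: a single forbidden value c > 0 leaves no vector of sum c.
comps∸≤avoiding : ∀ μ ν τ M →
  comps∸ M (constrained (μ ∷ ν ∷ τ)) (length (μ ∷ ν ∷ τ)) ≤ avoiding (μ ∷ ν ∷ τ) M
comps∸≤avoiding nothing  ν       τ       M = comps∸≤avoiding-free (ν ∷ τ) M
comps∸≤avoiding (just a) ν       (μ ∷ τ) M = comps∸-step (just a) _ _ (comps∸≤avoiding ν μ τ) M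
comps∸≤avoiding (just a) nothing []      M =
  ≤-trans (comps∸≤avoiding-free (just a ∷ []) M) (≤-reflexive (avoiding-swap nothing (just a) [] M))
comps∸≤avoiding (just a) (just b) []     M = comps∸≤avoiding-pair a b M

comps∸<avoiding-head : ∀ a τ M → 2 ≤ length τ → constrained τ ≤ M →
  comps∸ M (suc (constrained τ)) (suc (length τ)) < avoiding (just (suc a) ∷ τ) M
comps∸<avoiding-head a []          M ()              _
comps∸<avoiding-head a (ν ∷ [])    M (s≤s ())       _
comps∸<avoiding-head a (ν ∷ μ ∷ τ) M _   k≤M = comps∸-step-strict a _ _ (comps∸≤avoiding ν μ τ) M k≤M

comps∸<avoiding : ∀ τ M {c} → 0 < c → just c ∈ₗ τ → 3 ≤ length τ → constrained τ ≤ M →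
  comps∸ M (constrained τ) (length τ) < avoiding τ M
comps∸<avoiding τ M {suc a} _ c∈τ 3≤|τ| k≤M with τ₁ , τ₂ , refl ← ∈-∃++ c∈τ = begin-strict
  comps∸ M (constrained τ) (length τ)
    ≡⟨ cong₂ (comps∸ M) (constrained-move τ₁ μ τ₂) (length-++-sucʳ τ₁ μ τ₂) ⟩
  comps∸ M (suc (constrained (τ₁ ++ τ₂))) (suc (length (τ₁ ++ τ₂)))
    <⟨ comps∸<avoiding-head a (τ₁ ++ τ₂) M 2≤|τ₁++τ₂| k₁₂≤M ⟩
  avoiding (just (suc a) ∷ τ₁ ++ τ₂) M
    ≡⟨ sym (avoiding-move τ₁ μ τ₂ M) ⟩
  avoiding τ M ∎
  where
  open ≤-Reasoning
  μ : Maybe ℕ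
  μ = just (suc a)
  2≤|τ₁++τ₂| : 2 ≤ length (τ₁ ++ τ₂)
  2≤|τ₁++τ₂| = ≤-pred (subst (3 ≤_) (length-++-sucʳ τ₁ μ τ₂) 3≤|τ|)
  k₁₂≤M : constrained (τ₁ ++ τ₂) ≤ M
  k₁₂≤M = ≤-trans (n≤1+n _) (subst (_≤ M) (constrained-move τ₁ μ τ₂) k≤M)

-- Counting the vectors of 𝒟

private variable
  A B : Set

count : {P : Pred A 0ℓ} → Decidable P → List A → ℕ
count P? xs = length (filter P? xs)

module _ {P : Pred A 0ℓ} (P? : Decidable P) where

  count-≐ : {Q : Pred A 0ℓ} (Q? : Decidable Q) → P ≐ Q → ∀ xs → count P? xs ≡ count Q? xs
  count-≐ Q? P≐Q xs = cong length (filter-≐ P? Q? P≐Q xs)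

  count-none : (∀ x → ¬ P x) → ∀ xs → count P? xs ≡ 0
  count-none ¬P xs = cong length (filter-none P? (universal ¬P xs))

  count-++ : ∀ xs ys → count P? (xs ++ ys) ≡ count P? xs + count P? ys
  count-++ xs ys = trans (cong length (filter-++ P? xs ys)) (length-++ (filter P? xs))

  count-map : (g : B → A) → ∀ xs → count P? (map g xs) ≡ count (P? ∘ g) xs
  count-map g []       = refl
  count-map g (x ∷ xs) with does (P? (g x))
  ... | true  = cong suc (count-map g xs)
  ... | false = count-map g xs

  count-concatMap : (f : B → List A) → ∀ xs → count P? (concatMap f xs) ≡ listSum (map (count P? ∘ f) xs)
  count-concatMap f []       = refl
  count-concatMap f (x ∷ xs) =
    trans (count-++ (f x) (concatMap f xs)) (cong (count P? (f x) +_) (count-concatMap f xs))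

  count-filter : {Q : Pred A 0ℓ} (Q? : Decidable Q) → ∀ xs →
                 length (filter P? (filter Q? xs)) ≡ count (λ x → Q? x ×-dec P? x) xs
  count-filter Q? []       = refl
  count-filter Q? (x ∷ xs) with Q? x
  ... | no  _ = count-filter Q? xs
  ... | yes _ with P? x
  ...   | yes _ = cong suc (count-filter Q? xs)
  ...   | no  _ = count-filter Q? xs

  count-partition : {Q : Pred A 0ℓ} (Q? : Decidable Q) → ∀ xs →
    count (λ x → P? x ×-dec Q? x) xs + count (λ x → P? x ×-dec ¬? (Q? x)) xs ≡ count P? xs
  count-partition Q? []       = refl
  count-partition Q? (x ∷ xs) with P? x
  ... | no  _ = count-partition Q? xs
  ... | yes _ with Q? x
  ...   | yes _ = cong suc (count-partition Q? xs)
  ...   | no  _ = trans (+-suc _ _) (cong suc (count-partition Q? xs))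

#sum : ∀ k n N {R : Pred (Vec ℕ k) 0ℓ} → Decidable R → ℕ
#sum k n N R? = count (λ v → (sum v ≟ N) ×-dec R? v) (vecsBelow k n)

count-by-head : ∀ k n N {R : Pred (Vec ℕ (suc k)) 0ℓ} (R? : Decidable R) → N < n →
  #sum (suc k) n N R? ≡ conv N (λ a z → #sum k n z (λ u → R? (a ∷ u)))
count-by-head k n N {R} R? N<n = begin
  #sum (suc k) n N R?
    ≡⟨ count-concatMap P? (λ a → map (a ∷_) (vecsBelow k n)) (upTo n) ⟩
  listSum (map (λ a → count P? (map (a ∷_) (vecsBelow k n))) (upTo n))
    ≡⟨ cong listSum (map-applyUpTo _ id n) ⟩
  listSum (applyUpTo (λ a → count P? (map (a ∷_) (vecsBelow k n))) n)
    ≡⟨ sum-applyUpTo≡conv N n _ N<n empty-above ⟩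
  conv N (λ a _ → count P? (map (a ∷_) (vecsBelow k n)))
    ≡⟨ conv-cong N head-fixed ⟩
  conv N (λ a z → #sum k n z (λ u → R? (a ∷ u))) ∎
  where
  open ≡-Reasoning
  P? : (v : Vec ℕ (suc k)) → Dec (sum v ≡ N × R v)
  P? v = (sum v ≟ N) ×-dec R? v
  empty-above : ∀ a → N < a → a < n → count P? (map (a ∷_) (vecsBelow k n)) ≡ 0
  empty-above a N<a _ = trans (count-map P? (a ∷_) (vecsBelow k n))
    (count-none (P? ∘ (a ∷_)) (λ u (a+Σu≡N , _) → <⇒≱ N<a (subst (a ≤_) a+Σu≡N (m≤m+n a (sum u))))
                (vecsBelow k n))
  head-fixed : ∀ a z → a + z ≡ N → count P? (map (a ∷_) (vecsBelow k n)) ≡ #sum k n z (λ u → R? (a ∷ u))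
  head-fixed a z a+z≡N = trans (count-map P? (a ∷_) (vecsBelow k n))
    (count-≐ (P? ∘ (a ∷_)) _
      ((λ (eq , r) → +-cancelˡ-≡ a _ _ (trans eq (sym a+z≡N)) , r) ,
       (λ (eq , r) → trans (cong (a +_) eq) a+z≡N , r))
      (vecsBelow k n))

count-compositions : ∀ q n N → N < n → count (λ v → sum v ≟ N) (vecsBelow q n) ≡ comps N q
count-compositions q n N N<n =
  trans (count-≐ (λ v → sum v ≟ N) _ ((_, tt) , proj₁) (vecsBelow q n)) (#sum-all q N N<n)
  where
  #sum-all : ∀ q N → N < n → #sum q n N U? ≡ comps N q
  #sum-all zero    zero    _   = refl
  #sum-all zero    (suc N) _   = refl
  #sum-all (suc q) N       N<n = trans (count-by-head q n N U? N<n)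
    (conv-cong N (λ _ z x+z≡N → #sum-all q z (≤-<-trans (m≤n+m z _) (subst (_< n) (sym x+z≡N) N<n))))

Hits : ∀ {q} → Subset q → (Fin q → ℕ) → Vec ℕ q → Set
Hits S y v = ∃ λ s → s ∈ S × lookup v s ≡ y s

Hits? : ∀ {q} (S : Subset q) (y : Fin q → ℕ) → Decidable (Hits S y)
Hits? S y v = any? (λ s → (s ∈? S) ×-dec (lookup v s ≟ y s))

mask : Bool → ℕ → Maybe ℕ
mask true  c = just c
mask false _ = nothing

masks : ∀ {q} → Subset q → (Fin q → ℕ) → List (Maybe ℕ)
masks []      y = []
masks (b ∷ S) y = mask b (y zero) ∷ masks S (y ∘ suc)

length-masks : ∀ {q} (S : Subset q) y → length (masks S y) ≡ q
length-masks []      y = refl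
length-masks (b ∷ S) y = cong suc (length-masks S (y ∘ suc))

constrained-masks : ∀ {q} (S : Subset q) y → constrained (masks S y) ≡ ∣ S ∣
constrained-masks []          y = refl
constrained-masks (true ∷ S)  y = cong suc (constrained-masks S (y ∘ suc))
constrained-masks (false ∷ S) y = constrained-masks S (y ∘ suc)

just-∈-masks : ∀ {q} {S : Subset q} (y : Fin q → ℕ) {s} → s ∈ S → just (y s) ∈ₗ masks S y
just-∈-masks y here        = Any.here refl
just-∈-masks y (there s∈S) = Any.there (just-∈-masks (y ∘ suc) s∈S)

module _ {q} {S : Subset q} {y : Fin (suc q) → ℕ} {a : ℕ} {u : Vec ℕ q} where

  Hits-∷⁻ : ∀ {b} → Hits (b ∷ S) y (a ∷ u) → mask b (y zero) ≡ just a ⊎ Hits S (y ∘ suc) u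
  Hits-∷⁻ (zero  , here      , a≡y₀) = inj₁ (cong just (sym a≡y₀))
  Hits-∷⁻ (suc s , there s∈S , eq)   = inj₂ (s , s∈S , eq)

  Hits-∷⁺ : ∀ {b} → mask b (y zero) ≡ just a ⊎ Hits S (y ∘ suc) u → Hits (b ∷ S) y (a ∷ u)
  Hits-∷⁺ {true}  (inj₁ refl)             = zero , here , refl
  Hits-∷⁺         (inj₂ (s , s∈S , eq))   = suc s , there s∈S , eq

count-avoiding : ∀ {q} n N (S : Subset q) y → N < n → #sum q n N (¬? ∘ Hits? S y) ≡ avoiding (masks S y) N
count-avoiding n zero    [] y _   = refl
count-avoiding n (suc N) [] y _   = refl
count-avoiding {suc q} n N (b ∷ S) y N<n =
  trans (count-by-head q n N (¬? ∘ Hits? (b ∷ S) y) N<n) (conv-cong N head-term)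
  where
  head-term : ∀ a z → a + z ≡ N →
    #sum q n z (λ u → ¬? (Hits? (b ∷ S) y (a ∷ u))) ≡ allows (mask b (y zero)) a * avoiding (masks S (y ∘ suc)) z
  head-term a z a+z≡N with Maybe.≡-dec _≟_ (mask b (y zero)) (just a)
  ... | yes μ≡a = trans
    (count-none _ (λ u (_ , ¬hit) → ¬hit (Hits-∷⁺ (inj₁ μ≡a))) (vecsBelow q n))
    (sym (cong (_* avoiding (masks S (y ∘ suc)) z) (trans (cong (λ μ → allows μ a) μ≡a) (allows-self a))))
  ... | no  μ≢a = begin
    #sum q n z (λ u → ¬? (Hits? (b ∷ S) y (a ∷ u)))
      ≡⟨ count-≐ _ _ ((λ (eq , ¬hit) → eq , ¬hit ∘ Hits-∷⁺ ∘ inj₂) ,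
                      (λ (eq , ¬hit) → eq , [ μ≢a , ¬hit ] ∘ Hits-∷⁻)) (vecsBelow q n) ⟩
    #sum q n z (¬? ∘ Hits? S (y ∘ suc))
      ≡⟨ count-avoiding n z S (y ∘ suc) (≤-<-trans (m≤n+m z a) (subst (_< n) (sym a+z≡N) N<n)) ⟩
    avoiding (masks S (y ∘ suc)) z
      ≡⟨ sym (trans (cong (_* avoiding (masks S (y ∘ suc)) z) (allows-≢ _ a μ≢a)) (*-identityˡ _)) ⟩
    allows (mask b (y zero)) a * avoiding (masks S (y ∘ suc)) z ∎
    where open ≡-Reasoning

InD-∷ : ∀ t r (w : Fin (suc t) → ℕ) y S a u →
  InD (suc t) r w y S (a ∷ u) → a ≡ w zero × InD t r (w ∘ suc) y S u
InD-∷ t r w y S a u (pinned , hit) = pinned zero , (pinned ∘ suc) , hit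

count-pinned : ∀ t r (w : Fin t → ℕ) y S n N → sum (tabulate w) ≤ N → N < n →
  #sum (t + r) n N (InD? t r w y S) ≡ #sum r n (N ∸ sum (tabulate w)) (Hits? S y)
count-pinned zero    r w y S n N _ _ =
  count-≐ _ _ ((λ (eq , _ , hit) → eq , hit) , (λ (eq , hit) → eq , (λ ()) , hit)) (vecsBelow r n)
count-pinned (suc t) r w y S n N W≤N N<n = begin
  #sum (suc t + r) n N (InD? (suc t) r w y S)
    ≡⟨ count-by-head (t + r) n N (InD? (suc t) r w y S) N<n ⟩
  conv N (λ a z → #sum (t + r) n z (λ u → InD? (suc t) r w y S (a ∷ u)))
    ≡⟨ conv-single N w₀ w₀≤N unpinned ⟩
  #sum (t + r) n (N ∸ w₀) (λ u → InD? (suc t) r w y S (w₀ ∷ u))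
    ≡⟨ count-≐ _ _ ((λ (eq , ind) → eq , proj₂ (InD-∷ t r w y S w₀ _ ind)) ,
                    (λ (eq , pinned , hit) → eq , (λ { zero → refl ; (suc i) → pinned i }) , hit))
               (vecsBelow (t + r) n) ⟩
  #sum (t + r) n (N ∸ w₀) (InD? t r (w ∘ suc) y S)
    ≡⟨ count-pinned t r (w ∘ suc) y S n (N ∸ w₀) W′≤N∸w₀ (≤-<-trans (m∸n≤m N w₀) N<n) ⟩
  #sum r n (N ∸ w₀ ∸ W′) (Hits? S y)
    ≡⟨ cong (λ M → #sum r n M (Hits? S y)) (∸-+-assoc N w₀ W′) ⟩
  #sum r n (N ∸ (w₀ + W′)) (Hits? S y) ∎
  where
  open ≡-Reasoning
  w₀ W′ : ℕ
  w₀ = w zero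
  W′ = sum (tabulate (w ∘ suc))
  w₀≤N : w₀ ≤ N
  w₀≤N = ≤-trans (m≤m+n w₀ W′) W≤N
  W′≤N∸w₀ : W′ ≤ N ∸ w₀
  W′≤N∸w₀ = subst (_≤ N ∸ w₀) (m+n∸m≡n w₀ W′) (∸-monoˡ-≤ w₀ W≤N)
  unpinned : ∀ a z → a + z ≡ N → a ≢ w₀ → #sum (t + r) n z (λ u → InD? (suc t) r w y S (a ∷ u)) ≡ 0
  unpinned a z _ a≢w₀ =
    count-none _ (λ u (_ , ind) → a≢w₀ (proj₁ (InD-∷ t r w y S a u ind))) (vecsBelow (t + r) n)

length-𝒟+avoiding : ∀ t r (w : Fin t → ℕ) y S m → sum (tabulate w) ≤ m →
  length (𝒟 t r w y S m) + avoiding (masks S y) (m ∸ sum (tabulate w)) ≡ comps (m ∸ sum (tabulate w)) r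
length-𝒟+avoiding t r w y S m W≤m = begin
  length (𝒟 t r w y S m) + avoiding (masks S y) M
    ≡⟨ cong₂ _+_ |𝒟|≡#hits (sym (count-avoiding (suc m) M S y M<n)) ⟩
  #sum r (suc m) M (Hits? S y) + #sum r (suc m) M (¬? ∘ Hits? S y)
    ≡⟨ count-partition (λ v → sum v ≟ M) (Hits? S y) (vecsBelow r (suc m)) ⟩
  count (λ v → sum v ≟ M) (vecsBelow r (suc m))
    ≡⟨ count-compositions r (suc m) M M<n ⟩
  comps M r ∎
  where
  open ≡-Reasoning
  M : ℕ
  M = m ∸ sum (tabulate w)
  M<n : M < suc m
  M<n = s≤s (m∸n≤m m (sum (tabulate w)))
  |𝒟|≡#hits : length (𝒟 t r w y S m) ≡ #sum r (suc m) M (Hits? S y)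
  |𝒟|≡#hits = trans (count-filter (InD? t r w y S) (λ u → sum u ≟ m) (vecsBelow (t + r) (suc m)))
                    (count-pinned t r w y S (suc m) m W≤m ≤-refl)

sum-tabulate-pos : ∀ {n} (g : Fin n → ℕ) → 0 < sum (tabulate g) → ∃ λ i → 0 < g i
sum-tabulate-pos {suc n} g Σg>0 with g zero in g₀≡
... | suc _ = zero , subst (0 <_) (sym g₀≡) z<s
... | zero  with i , gi>0 ← sum-tabulate-pos (g ∘ suc) Σg>0 = suc i , gi>0

sumOver-pos : ∀ {r} (S : Subset r) (y : Fin r → ℕ) → 0 < sumOver S y → ∃ λ s → s ∈ S × 0 < y s
sumOver-pos S y Σy>0 with s , term>0 ← sum-tabulate-pos _ Σy>0 | s ∈? S
... | yes s∈S = s , s∈S , term>0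
... | no  _   = contradiction term>0 (<-irrefl refl)

comps∸<avoiding-masks : ∀ {r} (S : Subset r) y M → 3 ≤ r → ∣ S ∣ ≤ M → 0 < sumOver S y →
  comps∸ M ∣ S ∣ r < avoiding (masks S y) M
comps∸<avoiding-masks S y M 3≤r |S|≤M Σy>0 with s , s∈S , ys>0 ← sumOver-pos S y Σy>0 =
  subst₂ (λ k r → comps∸ M k r < avoiding (masks S y) M) (constrained-masks S y) (length-masks S y)
    (comps∸<avoiding (masks S y) M ys>0 (just-∈-masks y s∈S)
      (subst (3 ≤_) (sym (length-masks S y)) 3≤r)
      (subst (_≤ M) (sym (constrained-masks S y)) |S|≤M))

corollary2p5 : (t r : ℕ) → 1 ≤ t → 3 ≤ r →
    (w : Fin t → ℕ) (y : Fin r → ℕ) (S : Subset r) → Nonempty S →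
    (m : ℕ) → m ≥ ∣ S ∣ + sum (tabulate w) →
    0 < sumOver S y →
    length (𝒟 t r w y S m)
      < listSum (map (λ d → (m ∸ sum (tabulate w) ∸ d + r ∸ 2) C (r ∸ 2)) (upTo ∣ S ∣))
corollary2p5 t r _ 3≤r w y S _ m |S|+W≤m Σy>0 = +-cancelʳ-< (avoiding (masks S y) M) _ _ (begin-strict
  length (𝒟 t r w y S m) + avoiding (masks S y) M
    ≡⟨ length-𝒟+avoiding t r w y S m W≤m ⟩
  comps M r
    ≡⟨ sym (sum-binomial+comps∸ M k r (≤-trans (n≤1+n 2) 3≤r) k≤M) ⟩
  bound + comps∸ M k r
    <⟨ +-monoʳ-< bound (comps∸<avoiding-masks S y M 3≤r k≤M Σy>0) ⟩
  bound + avoiding (masks S y) M ∎)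
  where
  open ≤-Reasoning
  M k bound : ℕ
  M = m ∸ sum (tabulate w)
  k = ∣ S ∣
  bound = listSum (map (λ d → (M ∸ d + r ∸ 2) C (r ∸ 2)) (upTo k))
  W≤m : sum (tabulate w) ≤ m
  W≤m = ≤-trans (m≤n+m _ k) |S|+W≤m
  k≤M : k ≤ M
  k≤M = m+n≤o⇒m≤o∸n k |S|+W≤m
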